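{- Let $m\ge2$ and $j\in[2,m]$. Let $S_1=\{(1,m+1),(j,m+2)\}$ and $S_2=\{(1,m+2),(j,m+1)\}$, both elements of $\mathrm{Sub}(\beta_{m,2})$. Then exactly one of $S_1,S_2$ is valid.
   Context: For $N\ge1$, $[N]=\{1,\dots,N\}$. In the MVP parking process for a preference $p\in[N]^N$, cars $1,\dots,N$ enter in order a one-way street with spots $1,\dots,N$; car $i$ parks in spot $p_i$, and if $p_i$ was occupied by an earlier car $j$, car $j$ is bumped and parks in the first unoccupied spot $k>p_i$ (bumped cars do not bump others). The outcome $\mathcal{O}_{\mathrm{MVP}_N}(p)$ (when all cars park) is the permutation $\pi$ with $\pi_i$ the car in spot $i$ at the end. For $\pi\in S_N$, $\mathrm{Inv}(\pi)=\{(j,i):j<i,\ \pi_j>\pi_i\}$ and $\mathrm{Sub}(\pi)$ is the set of $S\subseteq\mathrm{Inv}(\pi)$ such that each $i$ has at most one $j$ with $(j,i)\in S$. For $S\in\mathrm{Sub}(\pi)$, $\Psi_{\mathrm{Sub}\to\mathrm{PF}}(S)$ is the preference $p$ with $p_{\pi_i}=i$ if no $(j,i)\in S$ and $p_{\pi_i}=j$ if $(j,i)\in S$; $S$ is valid if all cars park for $\Psi_{\mathrm{Sub}\to\mathrm{PF}}(S)$ and $\mathcal{O}_{\mathrm{MVP}_N}(\Psi_{\mathrm{Sub}\to\mathrm{PF}}(S))=\pi$. $\beta_{m,2}=3\,4\cdots(m+2)\,1\,2\in S_{m+2}$. -}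

module Defs where

open import Data.Nat using (ℕ; zero; suc; _+_; _∸_; _<_; _≤_; _>_; _≡ᵇ_)
open import Data.Bool using (Bool; true; false; if_then_else_)
open import Data.List using (List; []; _∷_; _++_; map; upTo; length; replicate; foldl)
open import Data.List.Membership.Propositional using (_∈_)
open import Data.List.Relation.Unary.All using (All)
open import Data.Maybe using (Maybe; just; nothing; _>>=_)
open import Data.Product using (_×_; _,_; proj₁; proj₂)
open import Relation.Binary.PropositionalEquality using (_≡_)

-- Conventions: a permutation π ∈ S_N is the list [π_1, …, π_N] (values in 1..N).
-- A street of N spots is a list of length N; entry k (0-based) is spot k+1,
-- holding 'just c' if car c is parked there.

-- 1-based lookup in a list of naturals (default 0 out of range)
nth : ℕ → List ℕ → ℕ
nth _ [] = 0
nth zero _ = 0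
nth (suc zero) (x ∷ xs) = x
nth (suc (suc k)) (x ∷ xs) = nth (suc k) xs

-- 1-based position of value c in a list (0 if absent)
posOf : ℕ → List ℕ → ℕ
posOf c [] = 0
posOf c (x ∷ xs) = if c ≡ᵇ x then 1 else (case (posOf c xs))
  where
  case : ℕ → ℕ
  case zero = 0
  case (suc k) = suc (suc k)

-- 0-based access/update of the street
getSpot : ℕ → List (Maybe ℕ) → Maybe ℕ
getSpot _ [] = nothing
getSpot zero (x ∷ _) = x
getSpot (suc k) (_ ∷ xs) = getSpot k xs

setSpot : ℕ → Maybe ℕ → List (Maybe ℕ) → List (Maybe ℕ)
setSpot _ _ [] = []
setSpot zero v (_ ∷ xs) = v ∷ xs
setSpot (suc k) v (x ∷ xs) = x ∷ setSpot k v xs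

parkFrom : ℕ → ℕ → List (Maybe ℕ) → Maybe (List (Maybe ℕ))
parkFrom _ c [] = nothing
parkFrom zero c (nothing ∷ xs) = just (just c ∷ xs)
parkFrom zero c (just d ∷ xs) = Data.Maybe.map (just d ∷_) (parkFrom zero c xs)
parkFrom (suc k) c (x ∷ xs) = Data.Maybe.map (x ∷_) (parkFrom k c xs)

-- one MVP step: car c with preferred spot s (1-based)
mvpStep : Maybe (List (Maybe ℕ)) → ℕ × ℕ → Maybe (List (Maybe ℕ))
mvpStep nothing _ = nothing
mvpStep (just st) (c , s) with getSpot (s ∸ 1) st
... | nothing = just (setSpot (s ∸ 1) (just c) st)
... | just d = parkFrom s d (setSpot (s ∸ 1) (just c) st)
  -- car d is bumped; first unoccupied spot k > s has 0-based index ≥ s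

withCars : ℕ → List ℕ → List (ℕ × ℕ)
withCars _ [] = []
withCars c (s ∷ ps) = (c , s) ∷ withCars (suc c) ps

allParked : List (Maybe ℕ) → Maybe (List ℕ)
allParked [] = just []
allParked (nothing ∷ _) = nothing
allParked (just c ∷ xs) = Data.Maybe.map (c ∷_) (allParked xs)

-- Outcome of MVP parking for preference p (N = length p);
-- just π iff all cars park, π listing the car in spots 1..N.
mvpOutcome : List ℕ → Maybe (List ℕ)
mvpOutcome p =
  foldl mvpStep (just (replicate (length p) nothing)) (withCars 1 p) >>= allParked

-- Inversions / Sub(π): S is a finite set of pairs (j , i), given as a list
IsInv : List ℕ → ℕ × ℕ → Set
IsInv π (j , i) = 1 ≤ j × j < i × i ≤ length π × nth j π > nth i π

IsSub : List ℕ → List (ℕ × ℕ) → Set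
IsSub π S = All (IsInv π) S ×
  (∀ a b → a ∈ S → b ∈ S → proj₂ a ≡ proj₂ b → proj₁ a ≡ proj₁ b)

partner : ℕ → List (ℕ × ℕ) → Maybe ℕ
partner i [] = nothing
partner i ((j , i') ∷ S) = if i ≡ᵇ i' then just j else partner i S

-- Ψ_{Sub→PF}: p_{π_i} = j if (j , i) ∈ S, else i
psi : List ℕ → List (ℕ × ℕ) → List ℕ
psi π S = map pref (map suc (upTo (length π)))
  where
  pref : ℕ → ℕ
  pref c with partner (posOf c π) S
  ... | just j = j
  ... | nothing = posOf c π

Valid : List ℕ → List (ℕ × ℕ) → Set
Valid π S = mvpOutcome (psi π S) ≡ just π

beta2 : ℕ → List ℕ
beta2 m = map (λ k → k + 3) (upTo m) ++ (1 ∷ 2 ∷ [])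

-- Under Ψ, car k+2 prefers spot k for every k ≤ m, while cars 1 and 2 prefer spots 1
-- and j, in an order that depends on S. When car k+2 arrives, spot k holds whichever of
-- cars 1, 2 is leftmost; that car is bumped to the first free spot after k, which lies
-- in the gap before the other car of the pair while there is one, and just past it
-- afterwards. The gap starts with j − 2 spots, so the pair changes order m − j + 2
-- times and ends in spots m+1, m+2. Hence S₁ or S₂ reproduces β_{m,2} = 3 ⋯ (m+2) 1 2
-- according to the parity of m − j, and exactly one of them does.
module Submission where

open import Defs
open import Data.Nat using (ℕ; zero; suc; _+_; _∸_; _<_; _≤_; _≡ᵇ_; z≤n; s≤s)
open import Data.Nat.Properties
  using ( _≟_; suc-injective; +-suc; +-comm; m≤n+m; m<m+n; <⇒≢; ≤-<-trans; ≤-trans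
        ; +-monoʳ-<; +-monoʳ-≤; m+[n∸m]≡n)
open import Data.List
  using (List; []; _∷_; _++_; [_]; map; upTo; applyUpTo; iterate; length; replicate; foldl)
open import Data.List.Properties
  using (++-assoc; ++-cancelˡ; length-++; length-map; length-upTo; length-iterate; length-replicate; map-upTo)
open import Data.List.Relation.Unary.All using ([]; _∷_)
open import Data.List.Relation.Unary.Any using (here; there)
open import Data.List.Membership.Propositional using (_∈_)
open import Data.Maybe using (Maybe; just; nothing; fromMaybe; _>>=_)
import Data.Maybe as Maybe
open import Data.Maybe.Properties using (map-∘; just-injective)
open import Data.Product using (_×_; _,_; proj₁; proj₂; swap)
open import Data.Sum using (_⊎_; inj₁; inj₂)
open import Data.Bool using (true; false)
open import Data.Empty using (⊥-elim)
open import Function.Base using (_∘_; _∋_)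
open import Relation.Nullary using (¬_)
open import Relation.Nullary.Decidable using (dec-true; dec-false)
open import Relation.Binary.PropositionalEquality
  using (_≡_; _≢_; refl; sym; trans; cong; cong₂; subst; subst₂; module ≡-Reasoning)
open ≡-Reasoning

≡ᵇ-refl : ∀ n → (n ≡ᵇ n) ≡ true
≡ᵇ-refl n = dec-true (n ≟ n) refl

≢⇒≡ᵇ-false : ∀ {m n} → m ≢ n → (m ≡ᵇ n) ≡ false
≢⇒≡ᵇ-false {m} {n} = dec-false (m ≟ n)

m+1≢m+2 : ∀ m → m + 1 ≢ m + 2
m+1≢m+2 m = <⇒≢ (+-monoʳ-< m (s≤s (s≤s z≤n)))

nth-map : ∀ {f : ℕ → ℕ} xs i → i < length xs → nth (suc i) (map f xs) ≡ f (nth (suc i) xs)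
nth-map (x ∷ xs) zero    _        = refl
nth-map (x ∷ xs) (suc i) (s≤s i<) = nth-map xs i i<

nth-applyUpTo : ∀ (f : ℕ → ℕ) n i → i < n → nth (suc i) (applyUpTo f n) ≡ f i
nth-applyUpTo f (suc n) zero    _        = refl
nth-applyUpTo f (suc n) (suc i) (s≤s i<) = nth-applyUpTo (f ∘ suc) n i i<

nth-iterate : ∀ a n i → i < n → nth (suc i) (iterate suc a n) ≡ i + a
nth-iterate a (suc n) zero    _        = refl
nth-iterate a (suc n) (suc i) (s≤s i<) = trans (nth-iterate (suc a) n i i<) (+-suc i a)

nth-++ʳ : ∀ (xs : List ℕ) {ys} n i → length xs ≡ n → nth (suc (n + i)) (xs ++ ys) ≡ nth (suc i) ys
nth-++ʳ []       _ i refl = refl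
nth-++ʳ (x ∷ xs) _ i refl = nth-++ʳ xs _ i refl

nth-++ˡ : ∀ (xs : List ℕ) {ys} i → i < length xs → nth (suc i) (xs ++ ys) ≡ nth (suc i) xs
nth-++ˡ (x ∷ xs) zero    _        = refl
nth-++ˡ (x ∷ xs) (suc i) (s≤s i<) = nth-++ˡ xs i i<

nth-ext : ∀ {xs ys : List ℕ} → length xs ≡ length ys →
  (∀ i → i < length xs → nth (suc i) xs ≡ nth (suc i) ys) → xs ≡ ys
nth-ext {[]}     {[]}     _   _  = refl
nth-ext {x ∷ xs} {y ∷ ys} len eq =
  cong₂ _∷_ (eq 0 (s≤s z≤n)) (nth-ext (suc-injective len) (λ i i< → eq (suc i) (s≤s i<)))

applyUpTo-iterate : ∀ (f : ℕ → ℕ) a n → (∀ i → f i ≡ i + a) → applyUpTo f n ≡ iterate suc a n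
applyUpTo-iterate f a zero    f≡ = refl
applyUpTo-iterate f a (suc n) f≡ =
  cong₂ _∷_ (f≡ 0) (applyUpTo-iterate (f ∘ suc) (suc a) n (λ i → trans (f≡ (suc i)) (sym (+-suc i a))))

map-iterate : ∀ (f : ℕ → ℕ) a b n → (∀ i → i < n → f (i + a) ≡ i + b) →
  map f (iterate suc a n) ≡ iterate suc b n
map-iterate f a b zero    f≡ = refl
map-iterate f a b (suc n) f≡ = cong₂ _∷_ (f≡ 0 (s≤s z≤n)) (map-iterate f (suc a) (suc b) n shifted)
  where
  shifted : ∀ i → i < n → f (i + suc a) ≡ i + suc b
  shifted i i< rewrite +-suc i a | +-suc i b = f≡ (suc i) (s≤s i<)

posOf-iterate : ∀ a n (ys : List ℕ) i → i < n → posOf (i + a) (iterate suc a n ++ ys) ≡ suc i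
posOf-iterate a (suc n) ys zero    _ rewrite ≡ᵇ-refl a = refl
posOf-iterate a (suc n) ys (suc i) (s≤s i<)
  rewrite sym (+-suc i a)
        | ≢⇒≡ᵇ-false (<⇒≢ (m≤n+m (suc a) i) ∘ sym)
        | posOf-iterate (suc a) n ys i i< = refl

-- posOf returns 0 for an absent value, so the shift by n needs c to occur in ys.
posOf-iterate-below : ∀ c a n (ys : List ℕ) t → c < a → posOf c ys ≡ suc t →
  posOf c (iterate suc a n ++ ys) ≡ n + suc t
posOf-iterate-below c a zero    ys t c<a pos = pos
posOf-iterate-below c a (suc n) ys t c<a pos
  rewrite ≢⇒≡ᵇ-false (<⇒≢ c<a)
        | posOf-iterate-below c (suc a) n ys t (≤-trans c<a (m≤n+m a 1)) pos
        | +-suc n t = refl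

beta2-iterate : ∀ m → beta2 m ≡ iterate suc 3 m ++ 1 ∷ 2 ∷ []
beta2-iterate m =
  cong (_++ 1 ∷ 2 ∷ []) (trans (map-upTo _ m) (applyUpTo-iterate (λ k → k + 3) 3 m (λ _ → refl)))

length-beta2 : ∀ m → length (beta2 m) ≡ 2 + m
length-beta2 m rewrite beta2-iterate m | length-++ (iterate suc 3 m) {1 ∷ 2 ∷ []} | length-iterate suc 3 m =
  +-comm m 2

nth-beta2-head : ∀ m i → i < m → nth (suc i) (beta2 m) ≡ i + 3
nth-beta2-head m i i<m rewrite beta2-iterate m =
  trans (nth-++ˡ (iterate suc 3 m) i (subst (i <_) (sym (length-iterate suc 3 m)) i<m)) (nth-iterate 3 m i i<m)

nth-beta2-tail : ∀ m t → t < 2 → nth (m + suc t) (beta2 m) ≡ suc t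
nth-beta2-tail m t t<2 rewrite beta2-iterate m | +-suc m t =
  trans (nth-++ʳ (iterate suc 3 m) m t (length-iterate suc 3 m)) (pair-entry t t<2)
  where
  pair-entry : ∀ t → t < 2 → nth (suc t) (1 ∷ 2 ∷ []) ≡ suc t
  pair-entry zero          _ = refl
  pair-entry (suc zero)    _ = refl
  pair-entry (suc (suc t)) (s≤s (s≤s ()))

posOf-beta2-head : ∀ m i → i < m → posOf (i + 3) (beta2 m) ≡ suc i
posOf-beta2-head m i i<m rewrite beta2-iterate m = posOf-iterate 3 m _ i i<m

posOf-beta2-tail : ∀ m t → t < 2 → posOf (suc t) (beta2 m) ≡ m + suc t
posOf-beta2-tail m t t<2 rewrite beta2-iterate m =
  posOf-iterate-below (suc t) 3 m _ t (s≤s t<2) (pair-position t t<2)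
  where
  pair-position : ∀ t → t < 2 → posOf (suc t) (1 ∷ 2 ∷ []) ≡ suc t
  pair-position zero          _ = refl
  pair-position (suc zero)    _ = refl
  pair-position (suc (suc t)) (s≤s (s≤s ()))

beta2-inversion : ∀ m i t → i < m → t < 2 → IsInv (beta2 m) (suc i , m + suc t)
beta2-inversion m i t i<m t<2 =
    s≤s z≤n
  , ≤-<-trans i<m (m<m+n m (s≤s z≤n))
  , subst (m + suc t ≤_) (trans (+-comm m 2) (sym (length-beta2 m))) (+-monoʳ-≤ m t<2)
  , subst₂ _<_ (sym (nth-beta2-tail m t t<2)) (sym (nth-beta2-head m i i<m)) (≤-trans (s≤s t<2) (m≤n+m 3 i))

IsSub-pair : ∀ π {a b} → IsInv π a → IsInv π b → proj₂ a ≢ proj₂ b → IsSub π (a ∷ b ∷ [])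
IsSub-pair π {a} {b} inv-a inv-b a≢b = inv-a ∷ inv-b ∷ [] , functional
  where
  functional : ∀ x y → x ∈ a ∷ b ∷ [] → y ∈ a ∷ b ∷ [] → proj₂ x ≡ proj₂ y → proj₁ x ≡ proj₁ y
  functional _ _ (here refl)         (here refl)         _ = refl
  functional _ _ (here refl)         (there (here refl)) e = ⊥-elim (a≢b e)
  functional _ _ (there (here refl)) (here refl)         e = ⊥-elim (a≢b (sym e))
  functional _ _ (there (here refl)) (there (here refl)) _ = refl

partner-here : ∀ i j S → partner i ((j , i) ∷ S) ≡ just j
partner-here i j S rewrite ≡ᵇ-refl i = refl

partner-there : ∀ i i′ j S → i ≢ i′ → partner i ((j , i′) ∷ S) ≡ partner i S
partner-there i i′ j S i≢i′ rewrite ≢⇒≡ᵇ-false i≢i′ = refl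

partner-below : ∀ m i t t′ a b → i < m →
  partner (suc i) ((a , m + suc t) ∷ (b , m + suc t′) ∷ []) ≡ nothing
partner-below m i t t′ a b i<m =
  trans (partner-there (suc i) (m + suc t) a ((b , m + suc t′) ∷ []) (below t))
        (partner-there (suc i) (m + suc t′) b [] (below t′))
  where
  below : ∀ t → suc i ≢ m + suc t
  below t = <⇒≢ (≤-<-trans i<m (m<m+n m (s≤s z≤n)))

preference : List ℕ → List (ℕ × ℕ) → ℕ → ℕ
preference π S c = fromMaybe (posOf c π) (partner (posOf c π) S)

preference-paired : ∀ π S c {p a} → posOf c π ≡ p → partner p S ≡ just a → preference π S c ≡ a
preference-paired π S c refl paired rewrite paired = refl

preference-unpaired : ∀ π S c {p} → posOf c π ≡ p → partner p S ≡ nothing → preference π S c ≡ p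
preference-unpaired π S c refl unpaired rewrite unpaired = refl

length-map-suc-upTo : ∀ n → length (map suc (upTo n)) ≡ n
length-map-suc-upTo n = trans (length-map suc (upTo n)) (length-upTo n)

-- The preference function of psi is local to its definition and cannot be named: the
-- ascription makes unification read it off the unfolding of psi, and the 'with' then
-- splits on the partner lookup inside it.
psi-entry : ∀ π S i → i < length π → nth (suc i) (psi π S) ≡ preference π S (suc i)
psi-entry π S i i<
  rewrite (nth (suc i) (psi π S) ≡ _) ∋
            nth-map (map suc (upTo (length π))) i (subst (i <_) (sym (length-map-suc-upTo (length π))) i<)
        | map-upTo suc (length π)
        | nth-applyUpTo suc (length π) i i<
  with partner (posOf (suc i) π) S
... | just _  = refl
... | nothing = refl

length-psi : ∀ π S → length (psi π S) ≡ length π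
length-psi π S = begin
  length (psi π S)                   ≡⟨ length-map _ (map suc (upTo (length π))) ⟩
  length (map suc (upTo (length π))) ≡⟨ length-map-suc-upTo (length π) ⟩
  length π                           ∎

psi-≡-map : ∀ π S → psi π S ≡ map (preference π S) (iterate suc 1 (length π))
psi-≡-map π S = nth-ext same-length entries
  where
  same-length : length (psi π S) ≡ length (map (preference π S) (iterate suc 1 (length π)))
  same-length = begin
    length (psi π S)                                         ≡⟨ length-psi π S ⟩
    length π                                                 ≡⟨ length-iterate suc 1 (length π) ⟨
    length (iterate suc 1 (length π))                        ≡⟨ length-map _ (iterate suc 1 (length π)) ⟨
    length (map (preference π S) (iterate suc 1 (length π))) ∎

  entries : ∀ i → i < length (psi π S) →
    nth (suc i) (psi π S) ≡ nth (suc i) (map (preference π S) (iterate suc 1 (length π)))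
  entries i i<psi = begin
    nth (suc i) (psi π S)                                        ≡⟨ psi-entry π S i i< ⟩
    preference π S (suc i)                                       ≡⟨ cong (preference π S) (+-comm 1 i) ⟩
    preference π S (i + 1)
      ≡⟨ cong (preference π S) (nth-iterate 1 (length π) i i<) ⟨
    preference π S (nth (suc i) (iterate suc 1 (length π)))
      ≡⟨ nth-map (iterate suc 1 (length π)) i i<iterate ⟨
    nth (suc i) (map (preference π S) (iterate suc 1 (length π))) ∎
    where
    i< : i < length π
    i< = subst (i <_) (length-psi π S) i<psi
    i<iterate : i < length (iterate suc 1 (length π))
    i<iterate = subst (i <_) (sym (length-iterate suc 1 (length π))) i<

psi-beta2 : ∀ m S a b → partner (m + 1) S ≡ just a → partner (m + 2) S ≡ just b →
  (∀ i → i < m → partner (suc i) S ≡ nothing) → psi (beta2 m) S ≡ a ∷ b ∷ iterate suc 1 m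
psi-beta2 m S a b paired₁ paired₂ unpaired = begin
  psi (beta2 m) S                                             ≡⟨ psi-≡-map (beta2 m) S ⟩
  map (preference (beta2 m) S) (iterate suc 1 (length (beta2 m)))
    ≡⟨ cong (map (preference (beta2 m) S) ∘ iterate suc 1) (length-beta2 m) ⟩
  preference (beta2 m) S 1 ∷ preference (beta2 m) S 2 ∷ map (preference (beta2 m) S) (iterate suc 3 m)
    ≡⟨ cong₂ _∷_ (preference-paired (beta2 m) S 1 (posOf-beta2-tail m 0 (s≤s z≤n)) paired₁)
         (cong₂ _∷_ (preference-paired (beta2 m) S 2 (posOf-beta2-tail m 1 (s≤s (s≤s z≤n))) paired₂)
           (map-iterate (preference (beta2 m) S) 3 1 m own-spot)) ⟩
  a ∷ b ∷ iterate suc 1 m                                     ∎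
  where
  own-spot : ∀ i → i < m → preference (beta2 m) S (i + 3) ≡ i + 1
  own-spot i i<m =
    trans (preference-unpaired (beta2 m) S (i + 3) (posOf-beta2-head m i i<m) (unpaired i i<m)) (+-comm 1 i)

psi-S₁ : ∀ m j → psi (beta2 m) ((1 , m + 1) ∷ (j , m + 2) ∷ []) ≡ 1 ∷ j ∷ iterate suc 1 m
psi-S₁ m j = psi-beta2 m ((1 , m + 1) ∷ (j , m + 2) ∷ []) 1 j
  (partner-here (m + 1) 1 ((j , m + 2) ∷ []))
  (trans (partner-there (m + 2) (m + 1) 1 ((j , m + 2) ∷ []) (m+1≢m+2 m ∘ sym)) (partner-here (m + 2) j []))
  (λ i i<m → partner-below m i 0 1 1 j i<m)

psi-S₂ : ∀ m j → psi (beta2 m) ((1 , m + 2) ∷ (j , m + 1) ∷ []) ≡ j ∷ 1 ∷ iterate suc 1 m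
psi-S₂ m j = psi-beta2 m ((1 , m + 2) ∷ (j , m + 1) ∷ []) j 1
  (trans (partner-there (m + 1) (m + 2) 1 ((j , m + 1) ∷ []) (m+1≢m+2 m)) (partner-here (m + 1) j []))
  (partner-here (m + 2) 1 ((j , m + 1) ∷ []))
  (λ i i<m → partner-below m i 1 0 1 j i<m)

Street : Set
Street = List (Maybe ℕ)

getSpot-++ : ∀ (Q : Street) x R → getSpot (length Q) (Q ++ x ∷ R) ≡ x
getSpot-++ []      x R = refl
getSpot-++ (_ ∷ Q) x R = getSpot-++ Q x R

setSpot-++ : ∀ (Q : Street) v x R → setSpot (length Q) v (Q ++ x ∷ R) ≡ Q ++ v ∷ R
setSpot-++ []      v x R = refl
setSpot-++ (q ∷ Q) v x R = cong (q ∷_) (setSpot-++ Q v x R)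

parkFrom-++ : ∀ (Q : Street) x d R →
  parkFrom (suc (length Q)) d (Q ++ x ∷ R) ≡ Maybe.map (λ R′ → Q ++ x ∷ R′) (parkFrom 0 d R)
parkFrom-++ []      x d R = refl
parkFrom-++ (q ∷ Q) x d R rewrite parkFrom-++ Q x d R = sym (map-∘ (parkFrom 0 d R))

park-free : ∀ (Q : Street) {k} c R → length Q ≡ k →
  mvpStep (just (Q ++ nothing ∷ R)) (c , suc k) ≡ just (Q ++ just c ∷ R)
park-free Q c R refl rewrite getSpot-++ Q nothing R | setSpot-++ Q (just c) nothing R = refl

park-bump : ∀ (Q : Street) c d R →
  mvpStep (just (Q ++ just d ∷ R)) (c , suc (length Q))
    ≡ Maybe.map (λ R′ → Q ++ just c ∷ R′) (parkFrom 0 d R)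
park-bump Q c d R rewrite getSpot-++ Q (just d) R | setSpot-++ Q (just c) (just d) R =
  parkFrom-++ Q (just c) d R

bump-then : ∀ (Q : Street) c d R R′ cars → parkFrom 0 d R ≡ just R′ →
  foldl mvpStep (just (Q ++ just d ∷ R)) ((c , suc (length Q)) ∷ cars)
    ≡ foldl mvpStep (just ((Q ++ [ just c ]) ++ R′)) cars
bump-then Q c d R R′ cars parked rewrite park-bump Q c d R | parked | ++-assoc Q [ just c ] R′ = refl

twoCars : ℕ → ℕ → ℕ → ℕ → Street
twoCars X Y e r = just X ∷ replicate e nothing ++ just Y ∷ replicate r nothing

swaps : ℕ → ℕ × ℕ → ℕ × ℕ
swaps zero    p = p
swaps (suc r) p = swaps r (swap p)

pairList : ℕ × ℕ → List ℕ
pairList (x , y) = x ∷ y ∷ []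

bump-into-gap : ∀ (Q : Street) c X Y e r cars →
  foldl mvpStep (just (Q ++ twoCars X Y (suc e) r)) ((c , suc (length Q)) ∷ cars)
    ≡ foldl mvpStep (just ((Q ++ [ just c ]) ++ twoCars X Y e r)) cars
bump-into-gap Q c X Y e r cars =
  bump-then Q c X (replicate (suc e) nothing ++ just Y ∷ replicate r nothing) (twoCars X Y e r) cars refl

bump-past : ∀ (Q : Street) c X Y r cars →
  foldl mvpStep (just (Q ++ twoCars X Y zero (suc r))) ((c , suc (length Q)) ∷ cars)
    ≡ foldl mvpStep (just ((Q ++ [ just c ]) ++ twoCars Y X zero r)) cars
bump-past Q c X Y r cars =
  bump-then Q c X (just Y ∷ replicate (suc r) nothing) (twoCars Y X zero r) cars refl

length-∷ʳ : ∀ (Q : Street) x → length (Q ++ [ x ]) ≡ suc (length Q)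
length-∷ʳ Q x = trans (length-++ Q) (+-comm (length Q) 1)

-- The street while cars 3, 4, … arrive: Q is settled and the next car prefers spot
-- length Q + 1, where X, the leftmost of cars 1 and 2, stands.
bumping : ∀ X Y e r (Q : Street) k c → length Q ≡ k →
  foldl mvpStep (just (Q ++ twoCars X Y e r)) (withCars c (iterate suc (suc k) (e + r)))
    ≡ just (Q ++ map just (iterate suc c (e + r) ++ pairList (swaps r (X , Y))))
bumping X Y zero    zero    Q _ c _    = refl
bumping X Y (suc e) r       Q _ c refl =
  trans (bump-into-gap Q c X Y e r (withCars (suc c) (iterate suc (2 + length Q) (e + r))))
    (trans (bumping X Y e r (Q ++ [ just c ]) _ (suc c) (length-∷ʳ Q (just c)))
      (cong just (++-assoc Q [ just c ] _)))
bumping X Y zero    (suc r) Q _ c refl =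
  trans (bump-past Q c X Y r (withCars (suc c) (iterate suc (2 + length Q) r)))
    (trans (bumping Y X zero r (Q ++ [ just c ]) _ (suc c) (length-∷ʳ Q (just c)))
      (cong just (++-assoc Q [ just c ] _)))

allParked-map-just : ∀ xs → allParked (map just xs) ≡ just xs
allParked-map-just []       = refl
allParked-map-just (x ∷ xs) rewrite allParked-map-just xs = refl

replicate-split : ∀ {A : Set} e r (x : A) →
  replicate (suc (e + r)) x ≡ replicate e x ++ x ∷ replicate r x
replicate-split zero    r x = refl
replicate-split (suc e) r x = cong (x ∷_) (replicate-split e r x)

empty-street : ∀ a b e r →
  replicate (length (a ∷ b ∷ iterate suc 1 (e + r))) (nothing {A = ℕ})
    ≡ nothing ∷ replicate e nothing ++ nothing ∷ replicate r nothing
empty-street a b e r =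
  trans (cong (λ n → replicate (2 + n) nothing) (length-iterate suc 1 (e + r)))
        (cong (nothing ∷_) (replicate-split e r nothing))

runFrom : Maybe Street → List (ℕ × ℕ) → Maybe (List ℕ)
runFrom street cars = foldl mvpStep street cars >>= allParked

outcome-from-twoCars : ∀ X Y e r →
  runFrom (just (twoCars X Y e r)) (withCars 3 (iterate suc 1 (e + r)))
    ≡ just (iterate suc 3 (e + r) ++ pairList (swaps r (X , Y)))
outcome-from-twoCars X Y e r rewrite bumping X Y e r [] 0 3 refl = allParked-map-just _

mvpOutcome-1j : ∀ m e r → m ≡ e + r →
  mvpOutcome (1 ∷ 2 + e ∷ iterate suc 1 m) ≡ just (iterate suc 3 m ++ pairList (swaps r (1 , 2)))
mvpOutcome-1j _ e r refl = begin
  mvpOutcome (1 ∷ 2 + e ∷ cars)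
    ≡⟨ cong (λ st → runFrom (just st) (withCars 1 (1 ∷ 2 + e ∷ cars))) (empty-street 1 (2 + e) e r) ⟩
  runFrom (mvpStep (just (just 1 ∷ gap e ++ nothing ∷ gap r)) (2 , 2 + e)) later
    ≡⟨ cong (λ st → runFrom st later)
            (park-free (just 1 ∷ gap e) 2 (gap r) (cong suc (length-replicate e))) ⟩
  runFrom (just (twoCars 1 2 e r)) later
    ≡⟨ outcome-from-twoCars 1 2 e r ⟩
  just (iterate suc 3 (e + r) ++ pairList (swaps r (1 , 2))) ∎
  where
  cars : List ℕ
  cars = iterate suc 1 (e + r)
  later : List (ℕ × ℕ)
  later = withCars 3 cars
  gap : ℕ → Street
  gap n = replicate n nothing

mvpOutcome-j1 : ∀ m e r → m ≡ e + r →
  mvpOutcome (2 + e ∷ 1 ∷ iterate suc 1 m) ≡ just (iterate suc 3 m ++ pairList (swaps r (2 , 1)))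
mvpOutcome-j1 _ e r refl = begin
  mvpOutcome (2 + e ∷ 1 ∷ cars)
    ≡⟨ cong (λ st → runFrom (just st) (withCars 1 (2 + e ∷ 1 ∷ cars))) (empty-street (2 + e) 1 e r) ⟩
  runFrom (mvpStep (mvpStep (just ((nothing ∷ gap e) ++ nothing ∷ gap r)) (1 , 2 + e)) (2 , 1)) later
    ≡⟨ cong (λ st → runFrom (mvpStep st (2 , 1)) later)
            (park-free (nothing ∷ gap e) 1 (gap r) (cong suc (length-replicate e))) ⟩
  runFrom (just (twoCars 2 1 e r)) later
    ≡⟨ outcome-from-twoCars 2 1 e r ⟩
  just (iterate suc 3 (e + r) ++ pairList (swaps r (2 , 1))) ∎
  where
  cars : List ℕ
  cars = iterate suc 1 (e + r)
  later : List (ℕ × ℕ)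
  later = withCars 3 cars
  gap : ℕ → Street
  gap n = replicate n nothing

swaps-parity : ∀ r x y →
    (swaps r (x , y) ≡ (x , y) × swaps r (y , x) ≡ (y , x))
  ⊎ (swaps r (x , y) ≡ (y , x) × swaps r (y , x) ≡ (x , y))
swaps-parity zero    x y = inj₁ (refl , refl)
swaps-parity (suc r) x y with swaps-parity r x y
... | inj₁ (same , swapped) = inj₂ (swapped , same)
... | inj₂ (swapped , same) = inj₁ (same , swapped)

Valid-beta2 : ∀ m S →
  mvpOutcome (psi (beta2 m) S) ≡ just (iterate suc 3 m ++ 1 ∷ 2 ∷ []) → Valid (beta2 m) S
Valid-beta2 m S outcome = trans outcome (cong just (sym (beta2-iterate m)))

¬Valid-beta2 : ∀ m S →
  mvpOutcome (psi (beta2 m) S) ≡ just (iterate suc 3 m ++ 2 ∷ 1 ∷ []) → ¬ Valid (beta2 m) S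
¬Valid-beta2 m S outcome valid =
  21≢12 (++-cancelˡ (iterate suc 3 m) (2 ∷ 1 ∷ []) (1 ∷ 2 ∷ [])
          (just-injective (trans (sym outcome) (trans valid (cong just (beta2-iterate m))))))
  where
  21≢12 : (List ℕ ∋ 2 ∷ 1 ∷ []) ≢ 1 ∷ 2 ∷ []
  21≢12 ()

exactly-one-valid : ∀ m S₁ S₂ r →
  mvpOutcome (psi (beta2 m) S₁) ≡ just (iterate suc 3 m ++ pairList (swaps r (1 , 2))) →
  mvpOutcome (psi (beta2 m) S₂) ≡ just (iterate suc 3 m ++ pairList (swaps r (2 , 1))) →
  (Valid (beta2 m) S₁ × ¬ Valid (beta2 m) S₂) ⊎ (¬ Valid (beta2 m) S₁ × Valid (beta2 m) S₂)
exactly-one-valid m S₁ S₂ r outcome₁ outcome₂ with swaps-parity r 1 2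
... | inj₁ (same , swapped) rewrite same | swapped =
  inj₁ (Valid-beta2 m S₁ outcome₁ , ¬Valid-beta2 m S₂ outcome₂)
... | inj₂ (swapped , same) rewrite same | swapped =
  inj₂ (¬Valid-beta2 m S₁ outcome₁ , Valid-beta2 m S₂ outcome₂)

lemma4p5 : (m j : ℕ) → 2 ≤ m → 2 ≤ j → j ≤ m →
    let S₁ = (1 , m + 1) ∷ (j , m + 2) ∷ []
        S₂ = (1 , m + 2) ∷ (j , m + 1) ∷ []
    in IsSub (beta2 m) S₁ × IsSub (beta2 m) S₂ ×
       ((Valid (beta2 m) S₁ × ¬ Valid (beta2 m) S₂) ⊎ (¬ Valid (beta2 m) S₁ × Valid (beta2 m) S₂))
lemma4p5 m (suc (suc e)) _ (s≤s (s≤s z≤n)) j≤m =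
    IsSub-pair (beta2 m) (beta2-inversion m 0 0 0<m 0<2) (beta2-inversion m (suc e) 1 j≤m 1<2) (m+1≢m+2 m)
  , IsSub-pair (beta2 m) (beta2-inversion m 0 1 0<m 1<2) (beta2-inversion m (suc e) 0 j≤m 0<2) (m+1≢m+2 m ∘ sym)
  , exactly-one-valid m S₁ S₂ (m ∸ e)
      (trans (cong mvpOutcome (psi-S₁ m (2 + e))) (mvpOutcome-1j m e (m ∸ e) m≡e+r))
      (trans (cong mvpOutcome (psi-S₂ m (2 + e))) (mvpOutcome-j1 m e (m ∸ e) m≡e+r))
  where
  S₁ S₂ : List (ℕ × ℕ)
  S₁ = (1 , m + 1) ∷ (2 + e , m + 2) ∷ []
  S₂ = (1 , m + 2) ∷ (2 + e , m + 1) ∷ []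
  0<m : 0 < m
  0<m = ≤-trans (s≤s z≤n) j≤m
  0<2 : 0 < 2
  0<2 = s≤s z≤n
  1<2 : 1 < 2
  1<2 = s≤s (s≤s z≤n)
  m≡e+r : m ≡ e + (m ∸ e)
  m≡e+r = sym (m+[n∸m]≡n (≤-trans (m≤n+m e 2) j≤m))
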